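{- Let $\Delta\in\mathcal{D}^8$ and let $B\subset V_T$ be an $8$-dimensional subspace satisfying the $\mathrm{p}_2$-condition. Let $x=(x_1,\dots,x_8)\in Q(\Delta,B)\subset S=E^8$ with $\langle x,x\rangle_Q=6$ (i.e. $\langle x,x\rangle_S=18$), and suppose $x\notin 3S$. Then the $8$-tuple $\nu(x)=[\langle x_1,x_1\rangle_E,\dots,\langle x_8,x_8\rangle_E]$ is obtained by a permutation of components from one of $[0,0,0,0,0,6,6,6]$, $[0,2,2,2,2,2,4,4]$, $[0,2,2,2,2,2,2,6]$, $[2,2,2,2,2,2,2,4]$.
   Context: $E$ is the root lattice of type $E_8$ (even unimodular of rank $8$). $U=E/3E$ carries the induced $\mathbb{F}_3$-valued symmetric bilinear form. A subspace $V\subset U$ is maximal isotropic if $\dim V=4$ and $\langle v,v\rangle=0$ for all $v\in V$. $\mathcal{D}$ is the set of ordered pairs $(V,W)$ of maximal isotropic subspaces with $V\cap W=0$; via the form, $W\cong\mathrm{Hom}(V,\mathbb{F}_3)$. Let $S=E^8$ (orthogonal sum), $T=\{1,\dots,8\}$, $S/3S=U_1\oplus\cdots\oplus U_8=U_T$. For $\Delta=((V_1,W_1),\dots,(V_8,W_8))\in\mathcal{D}^8$ put $V_T=\bigoplus_i V_i$, $W_T=\bigoplus_i W_i$. For an $8$-dimensional subspace $B\subset V_T$ let $B^\perp=\{\bar z\in W_T:\langle\bar z,\bar y\rangle=0\ \forall \bar y\in B\}$. With $\pi:S\to S/3S$ the projection, $Q(\Delta,B)$ is the lattice $\pi^{ -1}(B\oplus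 B^\perp)$ with form $\langle\,,\rangle_Q=\frac13\langle\,,\rangle_S$. $B$ satisfies the $\mathrm{p}_2$-condition if for all $i\ne j$ in $T$ the projection $B\to V_i\oplus V_j$ is an isomorphism. -}

module Defs where

open import Data.Nat using (ℕ; zero; suc; _≡ᵇ_)
open import Data.Bool using (Bool; true; false; if_then_else_; _∨_)
open import Data.Fin using (Fin; zero; suc; toℕ)
open import Data.Fin.Permutation using (Permutation′; _⟨$⟩ʳ_)
open import Data.Integer using (ℤ; +_; -[1+_]; _+_; _*_; _-_; 0ℤ)
open import Data.Integer.Divisibility using (_∣_)
open import Data.Product using (Σ; ∃; _×_; _,_)
open import Data.Sum using (_⊎_)
open import Data.Vec using (Vec; []; _∷_; lookup)
open import Relation.Binary.PropositionalEquality using (_≡_; _≢_)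
open import Function using (_∘_)

∑ : ∀ {n} → (Fin n → ℤ) → ℤ
∑ {zero}  f = 0ℤ
∑ {suc n} f = f zero + ∑ (f ∘ suc)

_≡₃_ : ℤ → ℤ → Set
a ≡₃ b = (+ 3) ∣ (a - b)

-- The E8 root lattice E, in coordinates w.r.t. a basis of simple roots.
-- Gram matrix = Cartan matrix of E8 (Bourbaki labelling, 0-based):
-- edges 0-2, 2-3, 3-4, 4-5, 5-6, 6-7, 1-3.

E : Set
E = Fin 8 → ℤ

edge : ℕ → ℕ → Bool
edge 0 2 = true
edge 2 3 = true
edge 3 4 = true
edge 4 5 = true
edge 5 6 = true
edge 6 7 = true
edge 1 3 = true
edge _ _ = false

cartan : Fin 8 → Fin 8 → ℤ
cartan i j =
  if toℕ i ≡ᵇ toℕ j then + 2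
  else if edge (toℕ i) (toℕ j) ∨ edge (toℕ j) (toℕ i) then -[1+ 0 ]
  else 0ℤ

formE : E → E → ℤ
formE x y = ∑ λ i → ∑ λ j → x i * cartan i j * y j

S : Set
S = Fin 8 → E

formS : S → S → ℤ
formS x y = ∑ λ i → formE (x i) (y i)

-- Elements of U = E/3E and of U_T = S/3S, represented by integer
-- representatives; equality in U is congruence mod 3.

_≡₃E_ : E → E → Set
u ≡₃E v = ∀ a → u a ≡₃ v a

_≡₃S_ : S → S → Set
x ≡₃S y = ∀ i → x i ≡₃E y i

0E : E
0E = λ _ → 0ℤ

0S : S
0S = λ _ → 0E

_+S_ : S → S → S
(x +S y) i a = x i a + y i a

combE : ∀ {k} → (Fin k → ℤ) → (Fin k → E) → E
combE c v a = ∑ λ t → c t * v t a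

combS : ∀ {k} → (Fin k → ℤ) → (Fin k → S) → S
combS c b i a = ∑ λ t → c t * b t i a

InSpanE : ∀ {k} → (Fin k → E) → E → Set
InSpanE v u = Σ (Fin _ → ℤ) λ c → u ≡₃E combE c v

InSpanS : ∀ {k} → (Fin k → S) → S → Set
InSpanS b y = Σ (Fin _ → ℤ) λ c → y ≡₃S combS c b

LinIndepE : ∀ {k} → (Fin k → E) → Set
LinIndepE {k} v = (c : Fin k → ℤ) → combE c v ≡₃E 0E → ∀ t → c t ≡₃ 0ℤ

LinIndepS : ∀ {k} → (Fin k → S) → Set
LinIndepS {k} b = (c : Fin k → ℤ) → combS c b ≡₃S 0S → ∀ t → c t ≡₃ 0ℤ

-- Maximal isotropic subspaces V ⊂ U, given by a basis (dim V = 4).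

IsMaxIsotropic : (Fin 4 → E) → Set
IsMaxIsotropic v =
  LinIndepE v × (∀ u → InSpanE v u → formE u u ≡₃ 0ℤ)

IsDPair : (Fin 4 → E) → (Fin 4 → E) → Set
IsDPair v w =
  IsMaxIsotropic v × IsMaxIsotropic w ×
  (∀ u → InSpanE v u → InSpanE w u → u ≡₃E 0E)

-- Δ ∈ 𝒟^8 is given by bases vs i of V_i and ws i of W_i.

InVT : (Fin 8 → Fin 4 → E) → S → Set
InVT vs y = ∀ i → InSpanE (vs i) (y i)

InWT : (Fin 8 → Fin 4 → E) → S → Set
InWT ws z = ∀ i → InSpanE (ws i) (z i)

IsSubspaceOfVT : (Fin 8 → Fin 4 → E) → (Fin 8 → S) → Set
IsSubspaceOfVT vs b = LinIndepS b × (∀ t → InVT vs (b t))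

InBperp : (Fin 8 → Fin 4 → E) → (Fin 8 → S) → S → Set
InBperp ws b z = InWT ws z × (∀ y → InSpanS b y → formS z y ≡₃ 0ℤ)

-- Q(Δ,B) = π⁻¹(B ⊕ B^⊥) ⊂ S
InQ : (Fin 8 → Fin 4 → E) → (Fin 8 → Fin 4 → E) → (Fin 8 → S) → S → Set
InQ vs ws b x =
  Σ S λ y → Σ S λ z → InSpanS b y × InBperp ws b z × x ≡₃S (y +S z)

-- p₂-condition: for i ≠ j the projection B → V_i ⊕ V_j is an isomorphism
-- (injective and surjective).
P2 : (Fin 8 → Fin 4 → E) → (Fin 8 → S) → Set
P2 vs b = ∀ i j → i ≢ j →
  (∀ y → InSpanS b y → y i ≡₃E 0E → y j ≡₃E 0E → y ≡₃S 0S) ×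
  (∀ u u′ → InSpanE (vs i) u → InSpanE (vs j) u′ →
     Σ S λ y → InSpanS b y × y i ≡₃E u × y j ≡₃E u′)

ν : S → Fin 8 → ℤ
ν x i = formE (x i) (x i)

fromVec : Vec ℤ 8 → Fin 8 → ℤ
fromVec v = lookup v

pattern₁ pattern₂ pattern₃ pattern₄ : Fin 8 → ℤ
pattern₁ = fromVec (+ 0 ∷ + 0 ∷ + 0 ∷ + 0 ∷ + 0 ∷ + 6 ∷ + 6 ∷ + 6 ∷ [])
pattern₂ = fromVec (+ 0 ∷ + 2 ∷ + 2 ∷ + 2 ∷ + 2 ∷ + 2 ∷ + 4 ∷ + 4 ∷ [])
pattern₃ = fromVec (+ 0 ∷ + 2 ∷ + 2 ∷ + 2 ∷ + 2 ∷ + 2 ∷ + 2 ∷ + 6 ∷ [])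
pattern₄ = fromVec (+ 2 ∷ + 2 ∷ + 2 ∷ + 2 ∷ + 2 ∷ + 2 ∷ + 2 ∷ + 4 ∷ [])

IsPermOf : (Fin 8 → ℤ) → (Fin 8 → ℤ) → Set
IsPermOf f g = Σ (Permutation′ 8) λ σ → ∀ i → f (σ ⟨$⟩ʳ i) ≡ g i

NuShape : S → Set
NuShape x =
  IsPermOf (ν x) pattern₁ ⊎ IsPermOf (ν x) pattern₂ ⊎
  IsPermOf (ν x) pattern₃ ⊎ IsPermOf (ν x) pattern₄

-- Write ν(x) = 2m: the E₈ norm is even and positive definite, so m : Fin 8 → ℕ sums to 9 and m i = 0
-- exactly when x i = 0.  Decompose x ≡ y + z with y ∈ B and z ∈ B^⊥ ⊆ W_T.
-- If y ≢ 0, a zero component x i forces y i ∈ V_i ∩ W_i = 0, so by injectivity in the p₂-condition at most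
-- one m i vanishes; distributing 9 over eight parts with at most one zero gives the last three patterns.
-- If y ≡ 0, every x i lies in the isotropic W_i, so 3 ∣ m i.  Were x supported on two components i and j,
-- surjectivity in the p₂-condition would give, for each v ∈ V_i, a y′ ∈ B with y′ i = v and y′ j = 0, and
-- pairing with x ≡ z ∈ B^⊥ makes x i orthogonal to V_i; as V_i ⊕ W_i = U and E is unimodular, x i ≡ 0.
-- So x has three components of norm 6, the first pattern.

module Submission where

open import Defs
open import Data.Fin using (Fin)
open import Data.Integer using (+_)
open import Relation.Binary.PropositionalEquality using (_≡_)
open import Relation.Nullary using (¬_)

open import Data.Bool using (if_then_else_)
open import Data.Empty using (⊥; ⊥-elim)
open import Data.Fin as Fin using (zero; suc; punchIn; punchOut; splitAt; _↑ˡ_; _↑ʳ_)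
open import Data.Fin.Patterns using (0F; 5F; 6F; 7F)
open import Data.Fin.Permutation as Perm using (Permutation′; _⟨$⟩ʳ_; _⟨$⟩ˡ_; _∘ₚ_)
import Data.Fin.Permutation.Components as PC
open import Data.Fin.Properties as FinP using (all?; any?; ¬∀⟶∃¬; punchIn-punchOut; punchInᵢ≢i)
open import Data.Integer as ℤ using (ℤ; -[1+_]; 0ℤ; _+_; _-_; -_; _*_; ∣_∣)
import Data.Integer.Divisibility.Signed as Div
import Data.Integer.Properties as ℤP
open import Data.Integer.Tactic.RingSolver using (solve-∀)
open import Data.Nat as ℕ using (ℕ)
import Data.Nat.Divisibility as ℕDiv
import Data.Nat.Primality as ℕPrime
import Data.Nat.Properties as ℕP
import Data.Nat.Tactic.RingSolver as ℕSolver
open import Algebra.Properties.Semiring.Sum ℕP.+-*-semiring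
  using (sum; sum-remove; sum-cong-≗; *-distribˡ-sum; *-distribʳ-sum)
open import Data.Product using (Σ; ∃; _×_; _,_; proj₁; proj₂)
open import Data.Sum using (_⊎_; inj₁; inj₂; map₂)
open import Data.Vec.Functional using ([]; _∷_; _++_)
open import Data.Vec.Functional.Properties using (lookup-++ˡ; lookup-++ʳ)
open import Function using (_∘_)
open import Relation.Binary.Bundles using (Setoid)
open import Relation.Binary.PropositionalEquality
  using (refl; sym; trans; cong; cong₂; subst; _≢_; module ≡-Reasoning)
import Relation.Binary.Reasoning.Setoid
open import Relation.Nullary using (Dec; yes; no)
open import Relation.Nullary.Decidable as Dec
  using (from-yes; from-no; dec-true; dec-false; decidable-stable; ¬?; _→-dec_)

-- Congruence mod 3, wrapped in a record so that both sides can be inferred from a proof.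
infix 4 _≈_ _≉_
record _≈_ (a b : ℤ) : Set where
  constructor mk
  field get : a ≡₃ b
open _≈_

_≉_ : ℤ → ℤ → Set
a ≉ b = ¬ (a ≈ b)

≈-by : ∀ {a b} c → + 3 Div.∣ c → c ≡ a - b → a ≈ b
≈-by c 3∣c refl = mk (Div.∣⇒∣ᵤ 3∣c)

3∣-diff : ∀ {a b} → a ≈ b → + 3 Div.∣ a - b
3∣-diff (mk p) = Div.∣ᵤ⇒∣ p

≈-reflexive : ∀ {a b} → a ≡ b → a ≈ b
≈-reflexive {a} refl = ≈-by 0ℤ (Div.divides 0ℤ refl) (sym (ℤP.+-inverseʳ a))

≈-refl : ∀ {a} → a ≈ a
≈-refl = ≈-reflexive refl

≈-sym : ∀ {a b} → a ≈ b → b ≈ a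
≈-sym {a} {b} p = ≈-by _ (Div.∣m⇒∣-m (3∣-diff p)) (flip a b)
  where
  flip : ∀ a b → - (a - b) ≡ b - a
  flip = solve-∀

≈-trans : ∀ {a b c} → a ≈ b → b ≈ c → a ≈ c
≈-trans {a} {b} {c} p q = ≈-by _ (Div.∣m∣n⇒∣m+n (3∣-diff p) (3∣-diff q)) (telescope a b c)
  where
  telescope : ∀ a b c → (a - b) + (b - c) ≡ a - c
  telescope = solve-∀

≈-setoid : Setoid _ _
≈-setoid = record
  { Carrier = ℤ ; _≈_ = _≈_
  ; isEquivalence = record { refl = ≈-refl ; sym = ≈-sym ; trans = ≈-trans } }

module ≈-Reasoning = Relation.Binary.Reasoning.Setoid ≈-setoid

+-cong : ∀ {a b c d} → a ≈ b → c ≈ d → a + c ≈ b + d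
+-cong {a} {b} {c} {d} p q = ≈-by _ (Div.∣m∣n⇒∣m+n (3∣-diff p) (3∣-diff q)) (regroup a b c d)
  where
  regroup : ∀ a b c d → (a - b) + (c - d) ≡ (a + c) - (b + d)
  regroup = solve-∀

-‿cong : ∀ {a b} → a ≈ b → - a ≈ - b
-‿cong {a} {b} p = ≈-by _ (Div.∣m⇒∣-m (3∣-diff p)) (negate a b)
  where
  negate : ∀ a b → - (a - b) ≡ - a - - b
  negate = solve-∀

*-cong : ∀ {a b c d} → a ≈ b → c ≈ d → a * c ≈ b * d
*-cong {a} {b} {c} {d} p q =
  ≈-by _ (Div.∣m∣n⇒∣m+n (Div.∣n⇒∣m*n a (3∣-diff q)) (Div.∣m⇒∣m*n d (3∣-diff p))) (expand a b c d)
  where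
  expand : ∀ a b c d → a * (c - d) + (a - b) * d ≡ a * c - b * d
  expand = solve-∀

*-congˡ : ∀ a {c d} → c ≈ d → a * c ≈ a * d
*-congˡ a = *-cong (≈-refl {a})

*-congʳ : ∀ {a b} c → a ≈ b → a * c ≈ b * c
*-congʳ c p = *-cong p (≈-refl {c})

+-cancelˡ-≈0 : ∀ a b → a ≈ 0ℤ → a + b ≈ 0ℤ → b ≈ 0ℤ
+-cancelˡ-≈0 a b a≈0 a+b≈0 =
  ≈-trans (≈-reflexive (sym (cancel a b))) (≈-trans (+-cong a+b≈0 (-‿cong a≈0)) ≈-refl)
  where
  cancel : ∀ a b → a + b + - a ≡ b
  cancel = solve-∀

+≈0⇒≈- : ∀ a b → a + b ≈ 0ℤ → a ≈ - b
+≈0⇒≈- a b a+b≈0 =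
  ≈-trans (≈-reflexive (sym (cancel a b))) (≈-trans (+-cong a+b≈0 (≈-refl { - b})) (≈-reflexive (ℤP.+-identityˡ (- b))))
  where
  cancel : ∀ a b → a + b + - b ≡ a
  cancel = solve-∀

≈0⇒3∣ : ∀ {a} → a ≈ 0ℤ → 3 ℕDiv.∣ ∣ a ∣
≈0⇒3∣ {a} (mk p) = subst (λ e → 3 ℕDiv.∣ ∣ e ∣) (ℤP.+-identityʳ a) p

3∣⇒≈0 : ∀ {a} → 3 ℕDiv.∣ ∣ a ∣ → a ≈ 0ℤ
3∣⇒≈0 {a} p = mk (subst (λ e → 3 ℕDiv.∣ ∣ e ∣) (sym (ℤP.+-identityʳ a)) p)

_≡₃?_ : ∀ a b → Dec (a ≡₃ b)
a ≡₃? b = 3 ℕDiv.∣? ∣ a - b ∣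

_≈?_ : ∀ a b → Dec (a ≈ b)
a ≈? b = Dec.map′ mk get (a ≡₃? b)

1≉0 : + 1 ≉ 0ℤ
1≉0 (mk p) = from-no (3 ℕDiv.∣? 1) p

2≉0 : + 2 ≉ 0ℤ
2≉0 (mk p) = from-no (3 ℕDiv.∣? 2) p

*-≈0 : ∀ a b → a * b ≈ 0ℤ → a ≈ 0ℤ ⊎ b ≈ 0ℤ
*-≈0 a b p with ℕPrime.euclidsLemma ∣ a ∣ ∣ b ∣ (from-yes (ℕPrime.prime? 3))
                  (subst (3 ℕDiv.∣_) (ℤP.abs-* a b) (≈0⇒3∣ p))
... | inj₁ 3∣a = inj₁ (3∣⇒≈0 3∣a)
... | inj₂ 3∣b = inj₂ (3∣⇒≈0 3∣b)

*-cancelˡ-≈0 : ∀ {a} b → a ≉ 0ℤ → a * b ≈ 0ℤ → b ≈ 0ℤ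
*-cancelˡ-≈0 {a} b a≉0 p with *-≈0 a b p
... | inj₁ a≈0 = ⊥-elim (a≉0 a≈0)
... | inj₂ b≈0 = b≈0

*-≉0 : ∀ {a b} → a ≉ 0ℤ → b ≉ 0ℤ → a * b ≉ 0ℤ
*-≉0 {a} {b} a≉0 b≉0 p = b≉0 (*-cancelˡ-≈0 b a≉0 p)

∑-cong : ∀ {n} {f g : Fin n → ℤ} → (∀ i → f i ≡ g i) → ∑ f ≡ ∑ g
∑-cong {ℕ.zero}  f≗g = refl
∑-cong {ℕ.suc n} f≗g = cong₂ _+_ (f≗g zero) (∑-cong (f≗g ∘ suc))

∑-cong-≈ : ∀ {n} {f g : Fin n → ℤ} → (∀ i → f i ≈ g i) → ∑ f ≈ ∑ g
∑-cong-≈ {ℕ.zero}  f≈g = ≈-refl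
∑-cong-≈ {ℕ.suc n} f≈g = +-cong (f≈g zero) (∑-cong-≈ (f≈g ∘ suc))

∑-zero : ∀ n → ∑ {n} (λ _ → 0ℤ) ≡ 0ℤ
∑-zero ℕ.zero    = refl
∑-zero (ℕ.suc n) = trans (ℤP.+-identityˡ _) (∑-zero n)

∑-≡0 : ∀ {n} {f : Fin n → ℤ} → (∀ i → f i ≡ 0ℤ) → ∑ f ≡ 0ℤ
∑-≡0 {n} f≗0 = trans (∑-cong f≗0) (∑-zero n)

∑-≈0 : ∀ {n} {f : Fin n → ℤ} → (∀ i → f i ≈ 0ℤ) → ∑ f ≈ 0ℤ
∑-≈0 {n} f≈0 = ≈-trans (∑-cong-≈ f≈0) (≈-reflexive (∑-zero n))

∑-+ : ∀ {n} (f g : Fin n → ℤ) → ∑ (λ i → f i + g i) ≡ ∑ f + ∑ g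
∑-+ {ℕ.zero}  f g = refl
∑-+ {ℕ.suc n} f g = trans (cong (λ e → f zero + g zero + e) (∑-+ (f ∘ suc) (g ∘ suc)))
                          (interchange (f zero) (g zero) (∑ (f ∘ suc)) (∑ (g ∘ suc)))
  where
  interchange : ∀ a b c d → (a + b) + (c + d) ≡ (a + c) + (b + d)
  interchange = solve-∀

∑-*ˡ : ∀ {n} k (f : Fin n → ℤ) → ∑ (λ i → k * f i) ≡ k * ∑ f
∑-*ˡ {ℕ.zero}  k f = sym (ℤP.*-zeroʳ k)
∑-*ˡ {ℕ.suc n} k f = trans (cong (λ e → k * f zero + e) (∑-*ˡ k (f ∘ suc)))
                           (sym (ℤP.*-distribˡ-+ k (f zero) _))

∑-*ʳ : ∀ {n} k (f : Fin n → ℤ) → ∑ (λ i → f i * k) ≡ ∑ f * k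
∑-*ʳ k f = trans (∑-cong (λ i → ℤP.*-comm (f i) k)) (trans (∑-*ˡ k f) (ℤP.*-comm k (∑ f)))

∑-neg : ∀ {n} (f : Fin n → ℤ) → ∑ (λ i → - f i) ≡ - ∑ f
∑-neg f = trans (∑-cong (λ i → sym (ℤP.-1*i≡-i (f i)))) (trans (∑-*ˡ (- + 1) f) (ℤP.-1*i≡-i (∑ f)))

∑-swap : ∀ {m n} (f : Fin m → Fin n → ℤ) → ∑ (λ i → ∑ (f i)) ≡ ∑ (λ j → ∑ (λ i → f i j))
∑-swap {ℕ.zero}  {n} f = sym (∑-zero n)
∑-swap {ℕ.suc m} {n} f = trans (cong (λ e → ∑ (f zero) + e) (∑-swap (f ∘ suc)))
                               (sym (∑-+ (f zero) (λ j → ∑ (λ i → f (suc i) j))))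

δ : ∀ {n} → Fin n → Fin n → ℤ
δ s t = if Dec.does (s FinP.≟ t) then + 1 else 0ℤ

∑-δ : ∀ {n} (s : Fin n) (f : Fin n → ℤ) → ∑ (λ t → δ s t * f t) ≡ f s
∑-δ {ℕ.suc n} zero f =
  trans (cong₂ _+_ (ℤP.*-identityˡ (f zero)) (∑-≡0 (λ t → ℤP.*-zeroˡ (f (suc t)))))
        (ℤP.+-identityʳ (f zero))
∑-δ {ℕ.suc n} (suc s) f =
  trans (cong₂ _+_ (ℤP.*-zeroˡ (f zero)) (∑-δ s (f ∘ suc))) (ℤP.+-identityˡ (f (suc s)))

∑-single-≈ : ∀ {n} {f : Fin n → ℤ} s → (∀ t → t ≢ s → f t ≈ 0ℤ) → ∑ f ≈ f s
∑-single-≈ {ℕ.suc n} {f} zero    f≈0 =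
  ≈-trans (+-cong (≈-refl {f zero}) (∑-≈0 λ t → f≈0 (suc t) λ ())) (≈-reflexive (ℤP.+-identityʳ (f zero)))
∑-single-≈ {ℕ.suc n} {f} (suc s) f≈0 =
  ≈-trans (+-cong (f≈0 zero λ ()) (∑-single-≈ s λ t t≢s → f≈0 (suc t) (t≢s ∘ FinP.suc-injective)))
          (≈-reflexive (ℤP.+-identityˡ (f (suc s))))

∑-++ : ∀ {k l} (f : Fin (k ℕ.+ l) → ℤ) → ∑ f ≡ ∑ (λ i → f (i ↑ˡ l)) + ∑ (λ i → f (k ↑ʳ i))
∑-++ {ℕ.zero}  f = sym (ℤP.+-identityˡ (∑ f))
∑-++ {ℕ.suc k} {l} f = trans (cong (λ e → f zero + e) (∑-++ {k} {l} (f ∘ suc))) (sym (ℤP.+-assoc (f zero) _ _))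

↑-elim : ∀ k {l} (P : Fin (k ℕ.+ l) → Set) → (∀ i → P (i ↑ˡ l)) → (∀ i → P (k ↑ʳ i)) → ∀ t → P t
↑-elim k P left right t with splitAt k t in eq
... | inj₁ i = subst P (FinP.splitAt⁻¹-↑ˡ eq) (left i)
... | inj₂ i = subst P (FinP.splitAt⁻¹-↑ʳ eq) (right i)

∑-pos : ∀ {n} (f : Fin n → ℕ) → ∑ (λ i → + f i) ≡ + sum f
∑-pos {ℕ.zero}  f = refl
∑-pos {ℕ.suc n} f = trans (cong (λ e → + f zero + e) (∑-pos (f ∘ suc))) (sym (ℤP.pos-+ (f zero) _))

sum≡0⇒≡0 : ∀ {n} (f : Fin n → ℕ) → sum f ≡ 0 → ∀ k → f k ≡ 0
sum≡0⇒≡0 f Σ≡0 zero    = ℕP.m+n≡0⇒m≡0 (f zero) Σ≡0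
sum≡0⇒≡0 f Σ≡0 (suc k) = sum≡0⇒≡0 (f ∘ suc) (ℕP.m+n≡0⇒n≡0 (f zero) Σ≡0) k

form : ∀ {n} → (Fin n → Fin n → ℤ) → (Fin n → ℤ) → (Fin n → ℤ) → ℤ
form M x y = ∑ λ i → ∑ λ j → x i * M i j * y j

module _ {n : ℕ} where

  form-cong : ∀ {M N : Fin n → Fin n → ℤ} x y → (∀ i j → M i j ≡ N i j) → form M x y ≡ form N x y
  form-cong x y M≡N = ∑-cong λ i → ∑-cong λ j → cong (λ e → x i * e * y j) (M≡N i j)

  form-cong-≈ : ∀ (M : Fin n → Fin n → ℤ) {x x′ y y′} → (∀ i → x i ≈ x′ i) → (∀ j → y j ≈ y′ j) →
                form M x y ≈ form M x′ y′
  form-cong-≈ M x≈x′ y≈y′ = ∑-cong-≈ λ i → ∑-cong-≈ λ j → *-cong (*-congʳ (M i j) (x≈x′ i)) (y≈y′ j)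

  form-row : ∀ M (x y : Fin n → ℤ) → form M x y ≡ ∑ (λ j → ∑ (λ i → x i * M i j) * y j)
  form-row M x y = trans (∑-swap (λ i j → x i * M i j * y j)) (∑-cong λ j → ∑-*ʳ (y j) (λ i → x i * M i j))

  form-transpose : ∀ M (x y : Fin n → ℤ) → form (λ i j → M j i) x y ≡ form M y x
  form-transpose M x y = trans (∑-swap (λ i j → x i * M j i * y j))
                               (∑-cong λ j → ∑-cong λ i → reverse (x i) (M j i) (y j))
    where
    reverse : ∀ a b c → a * b * c ≡ c * b * a
    reverse = solve-∀

  form-+ : ∀ M N (x y : Fin n → ℤ) → form (λ i j → M i j + N i j) x y ≡ form M x y + form N x y
  form-+ M N x y =
    trans (∑-cong λ i → trans (∑-cong λ j → distrib (x i) (M i j) (N i j) (y j))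
                              (∑-+ (λ j → x i * M i j * y j) (λ j → x i * N i j * y j)))
          (∑-+ (λ i → ∑ λ j → x i * M i j * y j) (λ i → ∑ λ j → x i * N i j * y j))
    where
    distrib : ∀ a b c d → a * (b + c) * d ≡ a * b * d + a * c * d
    distrib = solve-∀

  form-*ˡ : ∀ k M (x y : Fin n → ℤ) → k * form M x y ≡ form (λ i j → k * M i j) x y
  form-*ˡ k M x y =
    trans (sym (∑-*ˡ k λ i → ∑ λ j → x i * M i j * y j))
          (∑-cong λ i → trans (sym (∑-*ˡ k λ j → x i * M i j * y j)) (∑-cong λ j → shift k (x i) (M i j) (y j)))
    where
    shift : ∀ k a b c → k * (a * b * c) ≡ a * (k * b) * c
    shift = solve-∀

  form-+ʳ : ∀ M (x y y′ : Fin n → ℤ) → form M x (λ j → y j + y′ j) ≡ form M x y + form M x y′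
  form-+ʳ M x y y′ =
    trans (∑-cong λ i → trans (∑-cong λ j → ℤP.*-distribˡ-+ (x i * M i j) (y j) (y′ j))
                              (∑-+ (λ j → x i * M i j * y j) (λ j → x i * M i j * y′ j)))
          (∑-+ (λ i → ∑ λ j → x i * M i j * y j) (λ i → ∑ λ j → x i * M i j * y′ j))

  form-+ˡ : ∀ M (x x′ y : Fin n → ℤ) → form M (λ i → x i + x′ i) y ≡ form M x y + form M x′ y
  form-+ˡ M x x′ y =
    trans (∑-cong λ i → trans (∑-cong λ j → distrib (x i) (x′ i) (M i j) (y j))
                              (∑-+ (λ j → x i * M i j * y j) (λ j → x′ i * M i j * y j)))
          (∑-+ (λ i → ∑ λ j → x i * M i j * y j) (λ i → ∑ λ j → x′ i * M i j * y j))
    where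
    distrib : ∀ a b c d → (a + b) * c * d ≡ a * c * d + b * c * d
    distrib = solve-∀

  form-zeroʳ : ∀ M (x : Fin n → ℤ) → form M x (λ _ → 0ℤ) ≡ 0ℤ
  form-zeroʳ M x = ∑-≡0 λ i → ∑-≡0 λ j → ℤP.*-zeroʳ (x i * M i j)

  form-zeroˡ : ∀ M (y : Fin n → ℤ) → form M (λ _ → 0ℤ) y ≡ 0ℤ
  form-zeroˡ M y = ∑-≡0 λ i → ∑-≡0 λ j → trans (cong (_* y j) (ℤP.*-zeroˡ (M i j))) (ℤP.*-zeroˡ (y j))

  form-*ʳ : ∀ M (x : Fin n → ℤ) c y → form M x (λ j → c * y j) ≡ c * form M x y
  form-*ʳ M x c y =
    trans (∑-cong λ i → trans (∑-cong λ j → rotate (x i * M i j) c (y j)) (∑-*ˡ c λ j → x i * M i j * y j))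
          (∑-*ˡ c λ i → ∑ λ j → x i * M i j * y j)
    where
    rotate : ∀ a c y → a * (c * y) ≡ c * (a * y)
    rotate = solve-∀

  form-expand : ∀ M (z z′ : Fin n → ℤ) → form M (λ a → z a + z′ a) (λ a → z a + z′ a)
                                         ≡ form M z z + (form M z z′ + form M z′ z) + form M z′ z′
  form-expand M z z′ = begin
    form M z+z′ z+z′                                               ≡⟨ form-+ˡ M z z′ z+z′ ⟩
    form M z z+z′ + form M z′ z+z′                                 ≡⟨ cong₂ _+_ (form-+ʳ M z z z′) (form-+ʳ M z′ z z′) ⟩
    (form M z z + form M z z′) + (form M z′ z + form M z′ z′)
      ≡⟨ regroup (form M z z) (form M z z′) (form M z′ z) (form M z′ z′) ⟩
    form M z z + (form M z z′ + form M z′ z) + form M z′ z′        ∎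
    where
    open ≡-Reasoning
    z+z′ : Fin n → ℤ
    z+z′ a = z a + z′ a
    regroup : ∀ a b c d → (a + b) + (c + d) ≡ a + (b + c) + d
    regroup = solve-∀

  form-combʳ : ∀ {k} M (x : Fin n → ℤ) (c : Fin k → ℤ) (f : Fin k → Fin n → ℤ) →
               form M x (λ j → ∑ λ t → c t * f t j) ≡ ∑ (λ t → c t * form M x (f t))
  form-combʳ M x c f = begin
    form M x (λ j → ∑ λ t → c t * f t j)
      ≡⟨ ∑-cong (λ i → ∑-cong λ j → trans (sym (∑-*ˡ (x i * M i j) λ t → c t * f t j))
                                           (∑-cong λ t → swap (x i * M i j) (c t) (f t j))) ⟩
    ∑ (λ i → ∑ λ j → ∑ λ t → c t * (x i * M i j * f t j))
      ≡⟨ ∑-cong (λ i → ∑-swap λ j t → c t * (x i * M i j * f t j)) ⟩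
    ∑ (λ i → ∑ λ t → ∑ λ j → c t * (x i * M i j * f t j))
      ≡⟨ ∑-swap (λ i t → ∑ λ j → c t * (x i * M i j * f t j)) ⟩
    ∑ (λ t → ∑ λ i → ∑ λ j → c t * (x i * M i j * f t j))
      ≡⟨ ∑-cong (λ t → trans (∑-cong λ i → ∑-*ˡ (c t) λ j → x i * M i j * f t j)
                                (∑-*ˡ (c t) λ i → ∑ λ j → x i * M i j * f t j)) ⟩
    ∑ (λ t → c t * form M x (f t)) ∎
    where
    open ≡-Reasoning
    swap : ∀ a c f → a * (c * f) ≡ c * (a * f)
    swap = solve-∀

form-gram : ∀ {n m} (A : Fin n → Fin m → ℤ) (x y : Fin n → ℤ) →
            form (λ i j → ∑ λ k → A i k * A j k) x y
              ≡ ∑ (λ k → (∑ λ i → x i * A i k) * (∑ λ j → y j * A j k))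
form-gram A x y = begin
  form (λ i j → ∑ λ k → A i k * A j k) x y
    ≡⟨ ∑-cong (λ i → ∑-cong λ j → expand i j) ⟩
  ∑ (λ i → ∑ λ j → ∑ λ k → (x i * A i k) * (y j * A j k))
    ≡⟨ ∑-cong (λ i → ∑-swap λ j k → (x i * A i k) * (y j * A j k)) ⟩
  ∑ (λ i → ∑ λ k → ∑ λ j → (x i * A i k) * (y j * A j k))
    ≡⟨ ∑-swap (λ i k → ∑ λ j → (x i * A i k) * (y j * A j k)) ⟩
  ∑ (λ k → ∑ λ i → ∑ λ j → (x i * A i k) * (y j * A j k))
    ≡⟨ ∑-cong (λ k → trans (∑-cong λ i → ∑-*ˡ (x i * A i k) (λ j → y j * A j k)) (∑-*ʳ _ (λ i → x i * A i k))) ⟩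
  ∑ (λ k → (∑ λ i → x i * A i k) * (∑ λ j → y j * A j k)) ∎
  where
  open ≡-Reasoning
  rearrange : ∀ a b c d → a * (b * c) * d ≡ (a * b) * (d * c)
  rearrange = solve-∀
  expand : ∀ i j → x i * (∑ λ k → A i k * A j k) * y j ≡ ∑ (λ k → (x i * A i k) * (y j * A j k))
  expand i j = trans (cong (_* y j) (sym (∑-*ˡ (x i) λ k → A i k * A j k)))
                     (trans (sym (∑-*ʳ (y j) λ k → x i * (A i k * A j k)))
                            (∑-cong λ k → rearrange (x i) (A i k) (A j k) (y j)))

-- Rows are twice the simple roots of E₈ in Bourbaki's orthonormal coordinates, in the labelling of cartan.
doubledRoot : Fin 8 → Fin 8 → ℤ
doubledRoot =
    (+ 1 ∷ -[1+ 0 ] ∷ -[1+ 0 ] ∷ -[1+ 0 ] ∷ -[1+ 0 ] ∷ -[1+ 0 ] ∷ -[1+ 0 ] ∷ + 1 ∷ [])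
  ∷ (+ 2 ∷ + 2 ∷ + 0 ∷ + 0 ∷ + 0 ∷ + 0 ∷ + 0 ∷ + 0 ∷ [])
  ∷ (-[1+ 1 ] ∷ + 2 ∷ + 0 ∷ + 0 ∷ + 0 ∷ + 0 ∷ + 0 ∷ + 0 ∷ [])
  ∷ (+ 0 ∷ -[1+ 1 ] ∷ + 2 ∷ + 0 ∷ + 0 ∷ + 0 ∷ + 0 ∷ + 0 ∷ [])
  ∷ (+ 0 ∷ + 0 ∷ -[1+ 1 ] ∷ + 2 ∷ + 0 ∷ + 0 ∷ + 0 ∷ + 0 ∷ [])
  ∷ (+ 0 ∷ + 0 ∷ + 0 ∷ -[1+ 1 ] ∷ + 2 ∷ + 0 ∷ + 0 ∷ + 0 ∷ [])
  ∷ (+ 0 ∷ + 0 ∷ + 0 ∷ + 0 ∷ -[1+ 1 ] ∷ + 2 ∷ + 0 ∷ + 0 ∷ [])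
  ∷ (+ 0 ∷ + 0 ∷ + 0 ∷ + 0 ∷ + 0 ∷ -[1+ 1 ] ∷ + 2 ∷ + 0 ∷ [])
  ∷ []

-- The inverse of the Cartan matrix; its rows are the fundamental weights.
fundamentalWeight : Fin 8 → E
fundamentalWeight =
    (+ 4 ∷ + 5 ∷ + 7 ∷ + 10 ∷ + 8 ∷ + 6 ∷ + 4 ∷ + 2 ∷ [])
  ∷ (+ 5 ∷ + 8 ∷ + 10 ∷ + 15 ∷ + 12 ∷ + 9 ∷ + 6 ∷ + 3 ∷ [])
  ∷ (+ 7 ∷ + 10 ∷ + 14 ∷ + 20 ∷ + 16 ∷ + 12 ∷ + 8 ∷ + 4 ∷ [])
  ∷ (+ 10 ∷ + 15 ∷ + 20 ∷ + 30 ∷ + 24 ∷ + 18 ∷ + 12 ∷ + 6 ∷ [])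
  ∷ (+ 8 ∷ + 12 ∷ + 16 ∷ + 24 ∷ + 20 ∷ + 15 ∷ + 10 ∷ + 5 ∷ [])
  ∷ (+ 6 ∷ + 9 ∷ + 12 ∷ + 18 ∷ + 15 ∷ + 12 ∷ + 8 ∷ + 4 ∷ [])
  ∷ (+ 4 ∷ + 6 ∷ + 8 ∷ + 12 ∷ + 10 ∷ + 8 ∷ + 6 ∷ + 3 ∷ [])
  ∷ (+ 2 ∷ + 3 ∷ + 4 ∷ + 6 ∷ + 5 ∷ + 4 ∷ + 3 ∷ + 2 ∷ [])
  ∷ []

halfCartan : Fin 8 → Fin 8 → ℤ
halfCartan i j =
  if Fin.toℕ i ℕ.<ᵇ Fin.toℕ j then cartan i j
  else if Fin.toℕ i ℕ.≡ᵇ Fin.toℕ j then + 1 else 0ℤ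

cartan-sym : ∀ i j → cartan i j ≡ cartan j i
cartan-sym = from-yes (all? λ i → all? λ j → cartan i j ℤP.≟ cartan j i)

cartan≡half+halfᵀ : ∀ i j → cartan i j ≡ halfCartan i j + halfCartan j i
cartan≡half+halfᵀ = from-yes (all? λ i → all? λ j → cartan i j ℤP.≟ halfCartan i j + halfCartan j i)

4*cartan≡gram : ∀ i j → + 4 * cartan i j ≡ ∑ (λ k → doubledRoot i k * doubledRoot j k)
4*cartan≡gram = from-yes (all? λ i → all? λ j →
  + 4 * cartan i j ℤP.≟ ∑ (λ k → doubledRoot i k * doubledRoot j k))

fundamentalWeight-dual : ∀ b j → ∑ (λ i → fundamentalWeight b i * cartan i j) ≡ δ b j
fundamentalWeight-dual = from-yes (all? λ b → all? λ j →
  ∑ (λ i → fundamentalWeight b i * cartan i j) ℤP.≟ δ b j)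

formE-sym : ∀ x y → formE x y ≡ formE y x
formE-sym x y = trans (form-cong x y cartan-sym) (form-transpose cartan x y)

formE-even : ∀ u → formE u u ≡ + 2 * form halfCartan u u
formE-even u = begin
  formE u u                                         ≡⟨ form-cong u u cartan≡half+halfᵀ ⟩
  form (λ i j → halfCartan i j + halfCartan j i) u u ≡⟨ form-+ halfCartan (λ i j → halfCartan j i) u u ⟩
  form halfCartan u u + form (λ i j → halfCartan j i) u u
                                                    ≡⟨ cong (λ e → form halfCartan u u + e) (form-transpose halfCartan u u) ⟩
  form halfCartan u u + form halfCartan u u         ≡⟨ double (form halfCartan u u) ⟩
  + 2 * form halfCartan u u                         ∎
  where
  open ≡-Reasoning
  double : ∀ a → a + a ≡ + 2 * a
  double = solve-∀

rootCoords : E → Fin 8 → ℤ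
rootCoords x k = ∑ λ i → x i * doubledRoot i k

4*formE≡∑rootCoords : ∀ x y → + 4 * formE x y ≡ ∑ (λ k → rootCoords x k * rootCoords y k)
4*formE≡∑rootCoords x y =
  trans (form-*ˡ (+ 4) cartan x y) (trans (form-cong x y 4*cartan≡gram) (form-gram doubledRoot x y))

formE-fundamentalWeight : ∀ z b → formE z (fundamentalWeight b) ≡ z b
formE-fundamentalWeight z b = begin
  formE z (fundamentalWeight b)                                       ≡⟨ formE-sym z (fundamentalWeight b) ⟩
  formE (fundamentalWeight b) z                                       ≡⟨ form-row cartan (fundamentalWeight b) z ⟩
  ∑ (λ j → ∑ (λ i → fundamentalWeight b i * cartan i j) * z j)
    ≡⟨ ∑-cong (λ j → cong (_* z j) (fundamentalWeight-dual b j)) ⟩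
  ∑ (λ j → δ b j * z j)                                               ≡⟨ ∑-δ b z ⟩
  z b                                                                 ∎
  where open ≡-Reasoning

rootCoords≡0⇒≡0 : ∀ u → (∀ k → rootCoords u k ≡ 0ℤ) → ∀ b → u b ≡ 0ℤ
rootCoords≡0⇒≡0 u L≡0 b = ℤP.*-cancelˡ-≡ (+ 4) (u b) 0ℤ (begin
  + 4 * u b                                                     ≡⟨ cong (+ 4 *_) (sym (formE-fundamentalWeight u b)) ⟩
  + 4 * formE u ω                                               ≡⟨ 4*formE≡∑rootCoords u ω ⟩
  ∑ (λ k → rootCoords u k * rootCoords ω k)                     ≡⟨ ∑-≡0 (λ k → trans (cong (_* rootCoords ω k) (L≡0 k))
                                                                                      (ℤP.*-zeroˡ (rootCoords ω k))) ⟩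
  0ℤ                                                            ≡⟨ ℤP.*-zeroʳ (+ 4) ⟨
  + 4 * 0ℤ                                                      ∎)
  where
  open ≡-Reasoning
  ω : E
  ω = fundamentalWeight b

i*i≡∣i∣² : ∀ i → i * i ≡ + (∣ i ∣ ℕ.* ∣ i ∣)
i*i≡∣i∣² (+ n)    = sym (ℤP.pos-* n n)
i*i≡∣i∣² -[1+ n ] = refl

-- 4 formE u u is a sum of squares of rootCoords u, and cartan = halfCartan + halfCartanᵀ makes formE u u even.
formE-definite : ∀ u → ∃ λ m → formE u u ≡ + (2 ℕ.* m) × (m ≡ 0 → ∀ a → u a ≡ 0ℤ)
formE-definite u = go (form halfCartan u u) (formE-even u)
  where
  L : Fin 8 → ℤ
  L = rootCoords u
  squares : ℕ
  squares = sum λ k → ∣ L k ∣ ℕ.* ∣ L k ∣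
  4q≡squares : + 4 * formE u u ≡ + squares
  4q≡squares = trans (4*formE≡∑rootCoords u u)
                     (trans (∑-cong (λ k → i*i≡∣i∣² (L k))) (∑-pos (λ k → ∣ L k ∣ ℕ.* ∣ L k ∣)))
  L≡0 : squares ≡ 0 → ∀ k → L k ≡ 0ℤ
  L≡0 squares≡0 k with ℕP.m*n≡0⇒m≡0∨n≡0 ∣ L k ∣ (sum≡0⇒≡0 (λ k → ∣ L k ∣ ℕ.* ∣ L k ∣) squares≡0 k)
  ... | inj₁ ∣Lk∣≡0 = ℤP.∣i∣≡0⇒i≡0 ∣Lk∣≡0
  ... | inj₂ ∣Lk∣≡0 = ℤP.∣i∣≡0⇒i≡0 ∣Lk∣≡0
  go : ∀ h → formE u u ≡ + 2 * h → ∃ λ m → formE u u ≡ + (2 ℕ.* m) × (m ≡ 0 → ∀ a → u a ≡ 0ℤ)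
  go (+ m) q≡2m = m , trans q≡2m (sym (ℤP.pos-* 2 m)) , u≡0
    where
    u≡0 : m ≡ 0 → ∀ a → u a ≡ 0ℤ
    u≡0 refl = rootCoords≡0⇒≡0 u (L≡0 (ℤP.+-injective (trans (sym 4q≡squares) (cong (+ 4 *_) q≡2m))))
  go -[1+ k ] q≡neg = ⊥-elim (neg≢pos (trans (sym (cong (+ 4 *_) q≡neg)) 4q≡squares))
    where
    neg≢pos : ∀ {N} → + 4 * (+ 2 * -[1+ k ]) ≢ + N
    neg≢pos ()

module _ {k : ℕ} where

  combE-+ : ∀ (c c′ : Fin k → ℤ) v a → combE (λ t → c t + c′ t) v a ≡ combE c v a + combE c′ v a
  combE-+ c c′ v a = trans (∑-cong λ t → ℤP.*-distribʳ-+ (v t a) (c t) (c′ t))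
                           (∑-+ (λ t → c t * v t a) (λ t → c′ t * v t a))

  combE-neg : ∀ (c : Fin k → ℤ) v a → combE (λ t → - c t) v a ≡ - combE c v a
  combE-neg c v a = trans (∑-cong λ t → sym (ℤP.neg-distribˡ-* (c t) (v t a))) (∑-neg (λ t → c t * v t a))

  combE-comb : ∀ {l} (c : Fin l → ℤ) (d : Fin l → Fin k → ℤ) (v : Fin k → E) a →
               ∑ (λ t → c t * combE (d t) v a) ≡ combE (λ s → ∑ λ t → c t * d t s) v a
  combE-comb c d v a = begin
    ∑ (λ t → c t * ∑ λ s → d t s * v s a)   ≡⟨ ∑-cong (λ t → sym (∑-*ˡ (c t) λ s → d t s * v s a)) ⟩
    ∑ (λ t → ∑ λ s → c t * (d t s * v s a)) ≡⟨ ∑-swap (λ t s → c t * (d t s * v s a)) ⟩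
    ∑ (λ s → ∑ λ t → c t * (d t s * v s a)) ≡⟨ ∑-cong (λ s → trans (∑-cong λ t → sym (ℤP.*-assoc (c t) (d t s) (v s a)))
                                                                  (∑-*ʳ (v s a) λ t → c t * d t s)) ⟩
    ∑ (λ s → (∑ λ t → c t * d t s) * v s a) ∎
    where open ≡-Reasoning

  module _ {v : Fin k → E} where

    span-elim : ∀ u → InSpanE v u → ∃ λ c → ∀ a → u a ≈ combE c v a
    span-elim u (c , u≡c) = c , λ a → mk {u a} {combE c v a} (u≡c a)

    span-intro : ∀ {u} c → (∀ a → u a ≈ combE c v a) → InSpanE v u
    span-intro c u≈c = c , λ a → get (u≈c a)

    span-resp : ∀ {u u′} → (∀ a → u a ≈ u′ a) → InSpanE v u → InSpanE v u′
    span-resp {u} u≈u′ u∈span =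
      let c , u≈c = span-elim u u∈span in span-intro c λ a → ≈-trans (≈-sym (u≈u′ a)) (u≈c a)

    basis∈span : ∀ s → InSpanE v (v s)
    basis∈span s = span-intro (δ s) λ a → ≈-reflexive (sym (∑-δ s λ t → v t a))

    0∈span : InSpanE v 0E
    0∈span = span-intro (λ _ → 0ℤ) λ a → ≈-reflexive (sym (∑-≡0 λ t → ℤP.*-zeroˡ (v t a)))

    span-+ : ∀ {u u′} → InSpanE v u → InSpanE v u′ → InSpanE v (λ a → u a + u′ a)
    span-+ {u} {u′} u∈span u′∈span =
      let c , u≈c = span-elim u u∈span; c′ , u′≈c′ = span-elim u′ u′∈span in
      span-intro (λ t → c t + c′ t) λ a → ≈-trans (+-cong (u≈c a) (u′≈c′ a)) (≈-reflexive (sym (combE-+ c c′ v a)))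

    span-neg : ∀ {u} → InSpanE v u → InSpanE v (λ a → - u a)
    span-neg {u} u∈span =
      let c , u≈c = span-elim u u∈span in
      span-intro (λ t → - c t) λ a → ≈-trans (-‿cong (u≈c a)) (≈-reflexive (sym (combE-neg c v a)))

    span-comb : ∀ {l} (c : Fin l → ℤ) (f : Fin l → E) → (∀ t → InSpanE v (f t)) → InSpanE v (combE c f)
    span-comb c f f∈span = span-intro (λ s → ∑ λ t → c t * d t s)
      λ a → ≈-trans (∑-cong-≈ λ t → *-congˡ (c t) (proj₂ (span-elim (f t) (f∈span t)) a)) (≈-reflexive (combE-comb c d v a))
      where
      d : _ → Fin k → ℤ
      d t = proj₁ (span-elim (f t) (f∈span t))

-- On an isotropic subspace the bilinear form vanishes too, because 2 is invertible mod 3.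
isotropic⇒orthogonal : ∀ {k} {w : Fin k → E} → (∀ u → InSpanE w u → formE u u ≡₃ 0ℤ) →
                       ∀ {z z′} → InSpanE w z → InSpanE w z′ → formE z z′ ≈ 0ℤ
isotropic⇒orthogonal {w = w} isotropic {z} {z′} z∈W z′∈W = *-cancelˡ-≈0 (formE z z′) 2≉0 (begin
  + 2 * formE z z′                                         ≡⟨ twice (formE z z′) ⟨
  formE z z′ + formE z z′                                  ≡⟨ cong (λ e → formE z z′ + e) (formE-sym z z′) ⟩
  formE z z′ + formE z′ z                                  ≡⟨ cancel (formE z z) (formE z z′ + formE z′ z) (formE z′ z′) ⟨
  formE z z + (formE z z′ + formE z′ z) + formE z′ z′ + - formE z z + - formE z′ z′
                                                           ≈⟨ +-cong (+-cong q[z+z′]≈0 (-‿cong q[z]≈0)) (-‿cong q[z′]≈0) ⟩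
  0ℤ                                                       ∎)
  where
  open ≈-Reasoning
  twice : ∀ a → a + a ≡ + 2 * a
  twice = solve-∀
  cancel : ∀ a b c → a + b + c + - a + - c ≡ b
  cancel = solve-∀
  q[z]≈0 : formE z z ≈ 0ℤ
  q[z]≈0 = mk (isotropic z z∈W)
  q[z′]≈0 : formE z′ z′ ≈ 0ℤ
  q[z′]≈0 = mk (isotropic z′ z′∈W)
  q[z+z′]≈0 : formE z z + (formE z z′ + formE z′ z) + formE z′ z′ ≈ 0ℤ
  q[z+z′]≈0 = ≈-trans (≈-reflexive (sym (form-expand cartan z z′)))
                      (mk (isotropic (λ a → z a + z′ a) (span-+ {v = w} {z} {z′} z∈W z′∈W)))

record NontrivialRelation {m n} (f : Fin m → Fin n → ℤ) : Set where
  constructor relation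
  field
    coeff    : Fin m → ℤ
    nonzero  : ∃ λ t → coeff t ≉ 0ℤ
    vanishes : ∀ a → ∑ (λ t → coeff t * f t a) ≈ 0ℤ

∑-scaled-difference : ∀ {n} (d p q : Fin n → ℤ) r K →
  ∑ (λ t → d t * (r * p t - q t * K)) ≡ - ∑ (λ t → d t * q t) * K + ∑ (λ t → r * d t * p t)
∑-scaled-difference {ℕ.zero}  d p q r K = refl
∑-scaled-difference {ℕ.suc n} d p q r K =
  trans (cong (λ e → d zero * (r * p zero - q zero * K) + e) (∑-scaled-difference (d ∘ suc) (p ∘ suc) (q ∘ suc) r K))
        (step (d zero) (p zero) (q zero) r K (∑ λ t → d (suc t) * q (suc t)) (∑ λ t → r * d (suc t) * p (suc t)))
  where
  step : ∀ d p q r K Σq Σp → d * (r * p - q * K) + (- Σq * K + Σp) ≡ - (d * q + Σq) * K + (r * d * p + Σp)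
  step = solve-∀

-- Gaussian elimination, pivoting on a coordinate where the first vector is nonzero.
nontrivialRelation : ∀ n (f : Fin (ℕ.suc n) → Fin n → ℤ) → NontrivialRelation f
nontrivialRelation ℕ.zero    f = relation (λ _ → + 1) (zero , 1≉0) λ ()
nontrivialRelation (ℕ.suc n) f with all? (λ a → f zero a ≈? 0ℤ)
... | yes f₀≈0 = relation (δ zero) (zero , 1≉0) λ a → ≈-trans (≈-reflexive (∑-δ zero λ t → f t a)) (f₀≈0 a)
... | no f₀≉0  = pivot (¬∀⟶∃¬ (ℕ.suc n) _ (λ a → f zero a ≈? 0ℤ) f₀≉0)
  where
  pivot : (∃ λ a → f zero a ≉ 0ℤ) → NontrivialRelation f
  pivot (a , r≉0) = relation c (suc t₀ , *-≉0 r≉0 d₀≉0) c-vanishes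
    where
    r : ℤ
    r = f zero a
    -- Clearing coordinate a of every vector but the first with the first one.
    cleared : Fin (ℕ.suc n) → Fin (ℕ.suc n) → ℤ
    cleared t a′ = r * f (suc t) a′ - f (suc t) a * f zero a′
    open NontrivialRelation (nontrivialRelation n λ t b → cleared t (punchIn a b))
      renaming (coeff to d; nonzero to d-nonzero; vanishes to d-vanishes)
    t₀ = proj₁ d-nonzero
    d₀≉0 = proj₂ d-nonzero
    c : Fin (ℕ.suc (ℕ.suc n)) → ℤ
    c zero    = - ∑ (λ t → d t * f (suc t) a)
    c (suc t) = r * d t
    c≡d : ∀ a′ → ∑ (λ t → c t * f t a′) ≡ ∑ (λ t → d t * cleared t a′)
    c≡d a′ = sym (∑-scaled-difference d (λ t → f (suc t) a′) (λ t → f (suc t) a) r (f zero a′))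
    cancel : ∀ d r p → d * (r * p - p * r) ≡ 0ℤ
    cancel = solve-∀
    c-vanishes : ∀ a′ → ∑ (λ t → c t * f t a′) ≈ 0ℤ
    c-vanishes a′ with a FinP.≟ a′
    ... | yes refl = ≈-reflexive (trans (c≡d a) (∑-≡0 λ t → cancel (d t) r (f (suc t) a)))
    ... | no a≢a′  = ≈-trans (≈-reflexive (c≡d a′))
                             (subst (λ e → ∑ (λ t → d t * cleared t e) ≈ 0ℤ) (punchIn-punchOut a≢a′)
                                    (d-vanishes (punchOut a≢a′)))

-- The nine vectors u, f 0, …, f 7 are dependent, and independence of f forbids a zero coefficient on u.
independent-spans : (f : Fin 8 → E) → LinIndepE f → ∀ u → ∃ λ c → c ≉ 0ℤ × InSpanE f (λ a → c * u a)
independent-spans f f-independent u with nontrivialRelation 8 (u ∷ f)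
... | relation c (t₀ , c₀≉0) vanishes with c zero ≈? 0ℤ
...   | no  c≉0 = c zero , c≉0 , span-intro {v = f} (λ t → - c (suc t))
          λ a → ≈-trans (+≈0⇒≈- (c zero * u a) (combE (c ∘ suc) f a) (vanishes a))
                        (≈-reflexive (sym (combE-neg (c ∘ suc) f a)))
...   | yes c≈0 = ⊥-elim (c₀≉0 (c≈0-everywhere t₀))
  where
  c≈0-everywhere : ∀ t → c t ≈ 0ℤ
  c≈0-everywhere zero    = c≈0
  c≈0-everywhere (suc t) = mk (f-independent (c ∘ suc) (λ a → get (+-cancelˡ-≈0 (c zero * u a) (combE (c ∘ suc) f a)
                                                                                (*-congʳ (u a) c≈0) (vanishes a))) t)

++-independent : ∀ {k l} {v : Fin k → E} {w : Fin l → E} → LinIndepE v → LinIndepE w →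
                 (∀ u → InSpanE v u → InSpanE w u → u ≡₃E 0E) → LinIndepE (v ++ w)
++-independent {k} {l} {v} {w} v-independent w-independent V∩W≡0 c c≡0 = ↑-elim k (λ t → c t ≡₃ 0ℤ) cᵛ≡0 cʷ≡0
  where
  cᵛ cʷ : _ → ℤ
  cᵛ i = c (i ↑ˡ l)
  cʷ i = c (k ↑ʳ i)
  split : ∀ a → combE c (v ++ w) a ≡ combE cᵛ v a + combE cʷ w a
  split a = trans (∑-++ {k} {l} (λ t → c t * (v ++ w) t a))
                  (cong₂ _+_ (∑-cong λ i → cong (λ x → cᵛ i * x a) (lookup-++ˡ v w i))
                             (∑-cong λ i → cong (λ x → cʷ i * x a) (lookup-++ʳ v w i)))
  sum≈0 : ∀ a → combE cᵛ v a + combE cʷ w a ≈ 0ℤ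
  sum≈0 a = ≈-trans (≈-reflexive (sym (split a))) (mk (c≡0 a))
  combᵛ≡0 : combE cᵛ v ≡₃E 0E
  combᵛ≡0 = V∩W≡0 (combE cᵛ v) (span-intro {v = v} cᵛ λ a → ≈-refl)
              (span-resp {v = w} (λ a → ≈-sym (+≈0⇒≈- (combE cᵛ v a) (combE cʷ w a) (sum≈0 a)))
                         (span-neg {v = w} {combE cʷ w} (span-intro cʷ λ a → ≈-refl)))
  cᵛ≡0 : ∀ i → cᵛ i ≡₃ 0ℤ
  cᵛ≡0 = v-independent cᵛ combᵛ≡0
  cʷ≡0 : ∀ i → cʷ i ≡₃ 0ℤ
  cʷ≡0 = w-independent cʷ λ a → get (+-cancelˡ-≈0 (combE cᵛ v a) (combE cʷ w a) (mk (combᵛ≡0 a)) (sum≈0 a))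

-- V ⊕ W is everything, so z is orthogonal to all of U; pairing with the fundamental weights reads off its coordinates.
orthogonal-to-V⇒≈0 : ∀ {v w} → IsDPair v w → ∀ z → InSpanE w z → (∀ s → formE z (v s) ≈ 0ℤ) → ∀ a → z a ≈ 0ℤ
orthogonal-to-V⇒≈0 {v} {w} ((v-independent , _) , (w-independent , w-isotropic) , V∩W≡0) z z∈W z⊥V b =
  scaled (independent-spans (v ++ w) (++-independent {v = v} {w = w} v-independent w-independent V∩W≡0) ω)
  where
  ω : E
  ω = fundamentalWeight b
  z⊥V⊕W : ∀ t → formE z ((v ++ w) t) ≈ 0ℤ
  z⊥V⊕W = ↑-elim 4 (λ t → formE z ((v ++ w) t) ≈ 0ℤ)
    (λ i → subst (λ u → formE z u ≈ 0ℤ) (sym (lookup-++ˡ v w i)) (z⊥V i))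
    (λ i → subst (λ u → formE z u ≈ 0ℤ) (sym (lookup-++ʳ v w i))
                 (isotropic⇒orthogonal {w = w} w-isotropic {z} {w i} z∈W (basis∈span {v = w} i)))
  scaled : (∃ λ c → c ≉ 0ℤ × InSpanE (v ++ w) (λ a → c * ω a)) → z b ≈ 0ℤ
  scaled (c , c≉0 , cω∈span) = *-cancelˡ-≈0 (z b) c≉0 (begin
    c * z b                                   ≡⟨ cong (c *_) (formE-fundamentalWeight z b) ⟨
    c * formE z ω                             ≡⟨ form-*ʳ cartan z c ω ⟨
    formE z (λ a → c * ω a)                   ≈⟨ form-cong-≈ cartan {z} {z} (λ _ → ≈-refl) (proj₂ cω≈comb) ⟩
    formE z (combE d (v ++ w))                ≡⟨ form-combʳ cartan z d (v ++ w) ⟩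
    ∑ (λ t → d t * formE z ((v ++ w) t))      ≈⟨ ∑-≈0 (λ t → ≈-trans (*-congˡ (d t) (z⊥V⊕W t))
                                                                         (≈-reflexive (ℤP.*-zeroʳ (d t)))) ⟩
    0ℤ                                        ∎)
    where
    open ≈-Reasoning
    cω≈comb = span-elim {v = v ++ w} (λ a → c * ω a) cω∈span
    d = proj₁ cω≈comb

⟨$⟩ʳ-injective : ∀ {n} (σ : Permutation′ n) {i j} → σ ⟨$⟩ʳ i ≡ σ ⟨$⟩ʳ j → i ≡ j
⟨$⟩ʳ-injective σ {i} {j} σi≡σj = trans (sym (Perm.inverseˡ σ)) (trans (cong (σ ⟨$⟩ˡ_) σi≡σj) (Perm.inverseˡ σ))

transpose-hit : ∀ {n} (i j : Fin n) → PC.transpose i j i ≡ j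
transpose-hit i j rewrite dec-true (i FinP.≟ i) refl = refl

transpose-miss : ∀ {n} (i j k : Fin n) → k ≢ i → k ≢ j → PC.transpose i j k ≡ k
transpose-miss i j k k≢i k≢j rewrite dec-false (k FinP.≟ i) k≢i | dec-false (k FinP.≟ j) k≢j = refl

Distinct : ∀ {k n} → (Fin k → Fin n) → Set
Distinct a = ∀ s t → a s ≡ a t → s ≡ t

Distinct-[] : ∀ {n} → Distinct {n = n} []
Distinct-[] ()

Distinct-∷ : ∀ {k n} {x : Fin n} {xs : Fin k → Fin n} → (∀ s → xs s ≢ x) → Distinct xs → Distinct (x ∷ xs)
Distinct-∷ x∉xs xs-distinct zero    zero    _ = refl
Distinct-∷ x∉xs xs-distinct zero    (suc t) e = ⊥-elim (x∉xs t (sym e))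
Distinct-∷ x∉xs xs-distinct (suc s) zero    e = ⊥-elim (x∉xs s e)
Distinct-∷ x∉xs xs-distinct (suc s) (suc t) e = cong suc (xs-distinct s t e)

permutation-extending : ∀ {k n} (a b : Fin k → Fin n) → Distinct a → Distinct b →
                        ∃ λ (σ : Permutation′ n) → ∀ s → σ ⟨$⟩ʳ a s ≡ b s
permutation-extending {ℕ.zero}  a b _ _ = Perm.id , λ ()
permutation-extending {ℕ.suc k} a b a-distinct b-distinct =
  σ ∘ₚ Perm.transpose (σ ⟨$⟩ʳ a zero) (b zero) , τa≡b
  where
  rest = permutation-extending (a ∘ suc) (b ∘ suc) (λ s t e → FinP.suc-injective (a-distinct (suc s) (suc t) e))
                                                  (λ s t e → FinP.suc-injective (b-distinct (suc s) (suc t) e))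
  σ = proj₁ rest
  τa≡b : ∀ s → PC.transpose (σ ⟨$⟩ʳ a zero) (b zero) (σ ⟨$⟩ʳ a s) ≡ b s
  τa≡b zero    = transpose-hit (σ ⟨$⟩ʳ a zero) (b zero)
  τa≡b (suc s) rewrite proj₂ rest s =
    transpose-miss (σ ⟨$⟩ʳ a zero) (b zero) (b (suc s))
      (λ e → FinP.0≢1+n (sym (a-distinct (suc s) zero (⟨$⟩ʳ-injective σ (trans (proj₂ rest s) e)))))
      (λ e → FinP.0≢1+n (sym (b-distinct (suc s) zero e)))

distinct? : ∀ {k n} (a : Fin k → Fin n) → Dec (Distinct a)
distinct? a = all? λ s → all? λ t → a s FinP.≟ a t →-dec s FinP.≟ t

ConstantOff : ∀ {k} → (Fin 8 → ℤ) → ℤ → (Fin k → Fin 8) → Set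
ConstantOff f c a = ∀ i → (∀ s → a s ≢ i) → f i ≡ c

constantOff? : ∀ {k} f c (a : Fin k → Fin 8) → Dec (ConstantOff f c a)
constantOff? f c a = all? λ i → all? (λ s → ¬? (a s FinP.≟ i)) →-dec f i ℤP.≟ c

IsPermOf-byPositions : ∀ {k} (f g : Fin 8 → ℤ) c (a b : Fin k → Fin 8) → Distinct a → Distinct b →
  (∀ s → f (b s) ≡ g (a s)) → ConstantOff f c b → ConstantOff g c a → IsPermOf f g
IsPermOf-byPositions f g c a b a-distinct b-distinct f∘b≡g∘a f-elsewhere g-elsewhere =
  σ , λ i → matched i (any? λ s → a s FinP.≟ i)
  where
  extending = permutation-extending a b a-distinct b-distinct
  σ = proj₁ extending
  matched : ∀ i → Dec (∃ λ s → a s ≡ i) → f (σ ⟨$⟩ʳ i) ≡ g i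
  matched i (yes (s , refl)) = trans (cong f (proj₂ extending s)) (f∘b≡g∘a s)
  matched i (no  i∉a)        = trans (f-elsewhere (σ ⟨$⟩ʳ i) b≢σi) (sym (g-elsewhere i λ s as≡i → i∉a (s , as≡i)))
    where
    b≢σi : ∀ s → b s ≢ σ ⟨$⟩ʳ i
    b≢σi s bs≡σi = i∉a (s , ⟨$⟩ʳ-injective σ (trans (proj₂ extending s) bs≡σi))

pattern₁-at : ∀ f k l p → k ≢ l → k ≢ p → l ≢ p → f k ≡ + 6 → f l ≡ + 6 → f p ≡ + 6 →
              (∀ i → i ≢ k → i ≢ l → i ≢ p → f i ≡ 0ℤ) → IsPermOf f pattern₁
pattern₁-at f k l p k≢l k≢p l≢p fk fl fp elsewhere =
  IsPermOf-byPositions f pattern₁ 0ℤ (5F ∷ 6F ∷ 7F ∷ []) (k ∷ l ∷ p ∷ [])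
    (from-yes (distinct? (5F ∷ 6F ∷ 7F ∷ [])))
    (Distinct-∷ (λ { zero → k≢l ∘ sym ; (suc zero) → k≢p ∘ sym })
      (Distinct-∷ (λ { zero → l≢p ∘ sym }) (Distinct-∷ (λ ()) Distinct-[])))
    (λ { zero → fk ; (suc zero) → fl ; (suc (suc zero)) → fp })
    (λ i ∉ → elsewhere i (∉ zero ∘ sym) (∉ (suc zero) ∘ sym) (∉ (suc (suc zero)) ∘ sym))
    (from-yes (constantOff? pattern₁ 0ℤ (5F ∷ 6F ∷ 7F ∷ [])))

pattern₂-at : ∀ f k l p → k ≢ l → k ≢ p → l ≢ p → f k ≡ 0ℤ → f l ≡ + 4 → f p ≡ + 4 →
              (∀ i → i ≢ k → i ≢ l → i ≢ p → f i ≡ + 2) → IsPermOf f pattern₂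
pattern₂-at f k l p k≢l k≢p l≢p fk fl fp elsewhere =
  IsPermOf-byPositions f pattern₂ (+ 2) (0F ∷ 6F ∷ 7F ∷ []) (k ∷ l ∷ p ∷ [])
    (from-yes (distinct? (0F ∷ 6F ∷ 7F ∷ [])))
    (Distinct-∷ (λ { zero → k≢l ∘ sym ; (suc zero) → k≢p ∘ sym })
      (Distinct-∷ (λ { zero → l≢p ∘ sym }) (Distinct-∷ (λ ()) Distinct-[])))
    (λ { zero → fk ; (suc zero) → fl ; (suc (suc zero)) → fp })
    (λ i ∉ → elsewhere i (∉ zero ∘ sym) (∉ (suc zero) ∘ sym) (∉ (suc (suc zero)) ∘ sym))
    (from-yes (constantOff? pattern₂ (+ 2) (0F ∷ 6F ∷ 7F ∷ [])))

pattern₃-at : ∀ f k l → k ≢ l → f k ≡ 0ℤ → f l ≡ + 6 → (∀ i → i ≢ k → i ≢ l → f i ≡ + 2) → IsPermOf f pattern₃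
pattern₃-at f k l k≢l fk fl elsewhere =
  IsPermOf-byPositions f pattern₃ (+ 2) (0F ∷ 7F ∷ []) (k ∷ l ∷ [])
    (from-yes (distinct? (0F ∷ 7F ∷ [])))
    (Distinct-∷ (λ { zero → k≢l ∘ sym }) (Distinct-∷ (λ ()) Distinct-[]))
    (λ { zero → fk ; (suc zero) → fl })
    (λ i ∉ → elsewhere i (∉ zero ∘ sym) (∉ (suc zero) ∘ sym))
    (from-yes (constantOff? pattern₃ (+ 2) (0F ∷ 7F ∷ [])))

pattern₄-at : ∀ f k → f k ≡ + 4 → (∀ i → i ≢ k → f i ≡ + 2) → IsPermOf f pattern₄
pattern₄-at f k fk elsewhere =
  IsPermOf-byPositions f pattern₄ (+ 2) (7F ∷ []) (k ∷ [])
    (from-yes (distinct? (7F ∷ [])))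
    (Distinct-∷ (λ ()) Distinct-[])
    (λ { zero → fk })
    (λ i ∉ → elsewhere i (∉ zero ∘ sym))
    (from-yes (constantOff? pattern₄ (+ 2) (7F ∷ [])))

data Sum≡1 {n} (f : Fin n → ℕ) : Set where
  one : ∀ k → f k ≡ 1 → (∀ i → i ≢ k → f i ≡ 0) → Sum≡1 f

data Sum≡2 {n} (f : Fin n → ℕ) : Set where
  two     : ∀ k → f k ≡ 2 → (∀ i → i ≢ k → f i ≡ 0) → Sum≡2 f
  one+one : ∀ k l → k ≢ l → f k ≡ 1 → f l ≡ 1 → (∀ i → i ≢ k → i ≢ l → f i ≡ 0) → Sum≡2 f

data Sum≡3 {n} (f : Fin n → ℕ) : Set where
  three       : ∀ k → f k ≡ 3 → (∀ i → i ≢ k → f i ≡ 0) → Sum≡3 f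
  two+one     : ∀ k l → k ≢ l → f k ≡ 2 → f l ≡ 1 → (∀ i → i ≢ k → i ≢ l → f i ≡ 0) → Sum≡3 f
  one+one+one : ∀ k l p → k ≢ l → k ≢ p → l ≢ p → f k ≡ 1 → f l ≡ 1 → f p ≡ 1 →
                (∀ i → i ≢ k → i ≢ l → i ≢ p → f i ≡ 0) → Sum≡3 f

private
  suc≢suc : ∀ {n} {i j : Fin n} → i ≢ j → suc i ≢ suc j
  suc≢suc i≢j = i≢j ∘ FinP.suc-injective

  ≢suc : ∀ {n} {i j : Fin n} → suc i ≢ suc j → i ≢ j
  ≢suc si≢sj = si≢sj ∘ cong suc

  only-zero : ∀ {n} (f : Fin (ℕ.suc n) → ℕ) → sum (f ∘ suc) ≡ 0 → ∀ i → i ≢ zero → f i ≡ 0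
  only-zero f rest≡0 zero    i≢0 = ⊥-elim (i≢0 refl)
  only-zero f rest≡0 (suc i) _   = sum≡0⇒≡0 (f ∘ suc) rest≡0 i

sum≡1 : ∀ {n} (f : Fin n → ℕ) → sum f ≡ 1 → Sum≡1 f
sum≡1 {ℕ.suc n} f Σ≡1 with f zero in f₀
... | 0 with sum≡1 (f ∘ suc) Σ≡1
...   | one k fk rest = one (suc k) fk λ { zero _ → f₀ ; (suc i) i≢k → rest i (≢suc i≢k) }
sum≡1 {ℕ.suc n} f Σ≡1 | 1 = one zero f₀ (only-zero f (ℕP.suc-injective Σ≡1))

sum≡2 : ∀ {n} (f : Fin n → ℕ) → sum f ≡ 2 → Sum≡2 f
sum≡2 {ℕ.suc n} f Σ≡2 with f zero in f₀
... | 0 with sum≡2 (f ∘ suc) Σ≡2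
...   | two k fk rest = two (suc k) fk λ { zero _ → f₀ ; (suc i) i≢k → rest i (≢suc i≢k) }
...   | one+one k l k≢l fk fl rest =
        one+one (suc k) (suc l) (suc≢suc k≢l) fk fl λ { zero _ _ → f₀ ; (suc i) i≢k i≢l → rest i (≢suc i≢k) (≢suc i≢l) }
sum≡2 {ℕ.suc n} f Σ≡2 | 1 with sum≡1 (f ∘ suc) (ℕP.suc-injective Σ≡2)
...   | one k fk rest =
        one+one zero (suc k) (λ ()) f₀ fk λ { zero 0≢0 _ → ⊥-elim (0≢0 refl) ; (suc i) _ i≢k → rest i (≢suc i≢k) }
sum≡2 {ℕ.suc n} f Σ≡2 | 2 = two zero f₀ (only-zero f (ℕP.suc-injective (ℕP.suc-injective Σ≡2)))

sum≡3 : ∀ {n} (f : Fin n → ℕ) → sum f ≡ 3 → Sum≡3 f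
sum≡3 {ℕ.suc n} f Σ≡3 with f zero in f₀
... | 0 with sum≡3 (f ∘ suc) Σ≡3
...   | three k fk rest = three (suc k) fk λ { zero _ → f₀ ; (suc i) i≢k → rest i (≢suc i≢k) }
...   | two+one k l k≢l fk fl rest =
        two+one (suc k) (suc l) (suc≢suc k≢l) fk fl λ { zero _ _ → f₀ ; (suc i) i≢k i≢l → rest i (≢suc i≢k) (≢suc i≢l) }
...   | one+one+one k l p k≢l k≢p l≢p fk fl fp rest =
        one+one+one (suc k) (suc l) (suc p) (suc≢suc k≢l) (suc≢suc k≢p) (suc≢suc l≢p) fk fl fp
          λ { zero _ _ _ → f₀ ; (suc i) i≢k i≢l i≢p → rest i (≢suc i≢k) (≢suc i≢l) (≢suc i≢p) }
sum≡3 {ℕ.suc n} f Σ≡3 | 1 with sum≡2 (f ∘ suc) (ℕP.suc-injective Σ≡3)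
...   | two k fk rest =
        two+one (suc k) zero (λ ()) fk f₀ λ { zero _ 0≢0 → ⊥-elim (0≢0 refl) ; (suc i) i≢k _ → rest i (≢suc i≢k) }
...   | one+one k l k≢l fk fl rest =
        one+one+one zero (suc k) (suc l) (λ ()) (λ ()) (suc≢suc k≢l) f₀ fk fl
          λ { zero 0≢0 _ _ → ⊥-elim (0≢0 refl) ; (suc i) _ i≢k i≢l → rest i (≢suc i≢k) (≢suc i≢l) }
sum≡3 {ℕ.suc n} f Σ≡3 | 2 with sum≡1 (f ∘ suc) (ℕP.suc-injective (ℕP.suc-injective Σ≡3))
...   | one k fk rest =
        two+one zero (suc k) (λ ()) f₀ fk λ { zero 0≢0 _ → ⊥-elim (0≢0 refl) ; (suc i) _ i≢k → rest i (≢suc i≢k) }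
sum≡3 {ℕ.suc n} f Σ≡3 | 3 = three zero f₀ (only-zero f (ℕP.suc-injective (ℕP.suc-injective (ℕP.suc-injective Σ≡3))))

Shape : (Fin 8 → ℤ) → Set
Shape f = IsPermOf f pattern₁ ⊎ IsPermOf f pattern₂ ⊎ IsPermOf f pattern₃ ⊎ IsPermOf f pattern₄

IsPermOf-resp : ∀ {f f′ g} → (∀ i → f i ≡ f′ i) → IsPermOf f g → IsPermOf f′ g
IsPermOf-resp f≗f′ (σ , fσ≡g) = σ , λ i → trans (sym (f≗f′ (σ ⟨$⟩ʳ i))) (fσ≡g i)

Shape-resp : ∀ {f f′} → (∀ i → f i ≡ f′ i) → Shape f → Shape f′
Shape-resp f≗f′ (inj₁ p)               = inj₁ (IsPermOf-resp f≗f′ p)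
Shape-resp f≗f′ (inj₂ (inj₁ p))        = inj₂ (inj₁ (IsPermOf-resp f≗f′ p))
Shape-resp f≗f′ (inj₂ (inj₂ (inj₁ p))) = inj₂ (inj₂ (inj₁ (IsPermOf-resp f≗f′ p)))
Shape-resp f≗f′ (inj₂ (inj₂ (inj₂ p))) = inj₂ (inj₂ (inj₂ (IsPermOf-resp f≗f′ p)))

double : (Fin 8 → ℕ) → Fin 8 → ℤ
double m i = + (2 ℕ.* m i)

double-≡ : ∀ m {i n} → m i ≡ n → double m i ≡ + (2 ℕ.* n)
double-≡ m m≡n = cong (λ e → + (2 ℕ.* e)) m≡n

sum-suc : ∀ {n} (r : Fin n → ℕ) → sum (λ i → ℕ.suc (r i)) ≡ n ℕ.+ sum r
sum-suc {ℕ.zero}  r = refl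
sum-suc {ℕ.suc n} r = cong ℕ.suc (trans (cong (r zero ℕ.+_) (sum-suc (r ∘ suc))) (swap (r zero) n (sum (r ∘ suc))))
  where
  swap : ∀ a b c → a ℕ.+ (b ℕ.+ c) ≡ b ℕ.+ (a ℕ.+ c)
  swap = ℕSolver.solve-∀

punchIn-onto : ∀ {n} (z i : Fin (ℕ.suc n)) → i ≢ z → ∃ λ j → punchIn z j ≡ i
punchIn-onto z i i≢z = punchOut (i≢z ∘ sym) , punchIn-punchOut (i≢z ∘ sym)

double-shape-without-zero : ∀ (m : Fin 8 → ℕ) → sum m ≡ 9 → (∀ i → m i ≢ 0) → IsPermOf (double m) pattern₄
double-shape-without-zero m Σ≡9 m≢0 = from-Sum≡1 (sum≡1 r Σr≡1)
  where
  r : Fin 8 → ℕ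
  r i = ℕ.pred (m i)
  m≡1+r : ∀ i → m i ≡ ℕ.suc (r i)
  m≡1+r i = sym (ℕP.suc-pred (m i) {{ℕ.≢-nonZero (m≢0 i)}})
  Σr≡1 : sum r ≡ 1
  Σr≡1 = ℕP.+-cancelˡ-≡ 8 (sum r) 1 (trans (sym (sum-suc r)) (trans (sym (sum-cong-≗ m≡1+r)) Σ≡9))
  from-Sum≡1 : Sum≡1 r → IsPermOf (double m) pattern₄
  from-Sum≡1 (one k rk≡1 rest≡0) =
    pattern₄-at (double m) k (double-≡ m (trans (m≡1+r k) (cong ℕ.suc rk≡1)))
                             (λ i i≢k → double-≡ m (trans (m≡1+r i) (cong ℕ.suc (rest≡0 i i≢k))))

double-shape-with-one-zero : ∀ (m : Fin 8 → ℕ) z → sum m ≡ 9 → m z ≡ 0 → (∀ j → m (punchIn z j) ≢ 0) →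
                             IsPermOf (double m) pattern₂ ⊎ IsPermOf (double m) pattern₃
double-shape-with-one-zero m z Σ≡9 mz≡0 m≢0 = from-Sum≡2 (sum≡2 r Σr≡2)
  where
  r : Fin 7 → ℕ
  r j = ℕ.pred (m (punchIn z j))
  m≡1+r : ∀ j → m (punchIn z j) ≡ ℕ.suc (r j)
  m≡1+r j = sym (ℕP.suc-pred (m (punchIn z j)) {{ℕ.≢-nonZero (m≢0 j)}})
  Σr≡2 : sum r ≡ 2
  Σr≡2 = ℕP.+-cancelˡ-≡ 7 (sum r) 2 (begin
    7 ℕ.+ sum r                     ≡⟨ sum-suc r ⟨
    sum (λ j → ℕ.suc (r j))         ≡⟨ sum-cong-≗ m≡1+r ⟨
    sum (m ∘ punchIn z)             ≡⟨ cong (ℕ._+ sum (m ∘ punchIn z)) mz≡0 ⟨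
    m z ℕ.+ sum (m ∘ punchIn z)     ≡⟨ sum-remove {i = z} m ⟨
    sum m                           ≡⟨ Σ≡9 ⟩
    9                               ∎)
    where open ≡-Reasoning
  off-z : ∀ {P : Fin 8 → Set} → (∀ j → P (punchIn z j)) → ∀ i → i ≢ z → P i
  off-z {P} P∘punchIn i i≢z = let j , punchIn≡i = punchIn-onto z i i≢z in subst P punchIn≡i (P∘punchIn j)
  z≢punchIn : ∀ k → z ≢ punchIn z k
  z≢punchIn k = punchInᵢ≢i z k ∘ sym
  m≡ : ∀ {j n} → r j ≡ n → double m (punchIn z j) ≡ + (2 ℕ.* ℕ.suc n)
  m≡ {j} rj≡n = double-≡ m (trans (m≡1+r j) (cong ℕ.suc rj≡n))
  from-Sum≡2 : Sum≡2 r → IsPermOf (double m) pattern₂ ⊎ IsPermOf (double m) pattern₃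
  from-Sum≡2 (two k rk≡2 rest≡0) = inj₂
    (pattern₃-at (double m) z (punchIn z k) (z≢punchIn k) (double-≡ m mz≡0) (m≡ rk≡2)
       (off-z λ j j≢k → m≡ (rest≡0 j (j≢k ∘ cong (punchIn z)))))
  from-Sum≡2 (one+one k l k≢l rk≡1 rl≡1 rest≡0) = inj₁
    (pattern₂-at (double m) z (punchIn z k) (punchIn z l) (z≢punchIn k) (z≢punchIn l)
       (k≢l ∘ FinP.punchIn-injective z k l) (double-≡ m mz≡0) (m≡ rk≡1) (m≡ rl≡1)
       (off-z λ j j≢k j≢l → m≡ (rest≡0 j (j≢k ∘ cong (punchIn z)) (j≢l ∘ cong (punchIn z)))))

double-shape-with-unique-zero : ∀ (m : Fin 8 → ℕ) → sum m ≡ 9 → (∀ i j → m i ≡ 0 → m j ≡ 0 → i ≡ j) →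
                                IsPermOf (double m) pattern₂ ⊎ IsPermOf (double m) pattern₃ ⊎ IsPermOf (double m) pattern₄
double-shape-with-unique-zero m Σ≡9 zeros-unique with any? (λ i → m i ℕ.≟ 0)
... | no  no-zero        = inj₂ (inj₂ (double-shape-without-zero m Σ≡9 λ i mi≡0 → no-zero (i , mi≡0)))
... | yes (z , mz≡0)     = map₂ inj₁ (double-shape-with-one-zero m z Σ≡9 mz≡0
                             λ j m≡0 → punchInᵢ≢i z j (zeros-unique (punchIn z j) z m≡0 mz≡0))

double-shape-of-multiples-of-3 : ∀ (m : Fin 8 → ℕ) → sum m ≡ 9 → (∀ i → 3 ℕDiv.∣ m i) →
  (∀ i j → i ≢ j → (∀ k → k ≢ i → k ≢ j → m k ≡ 0) → ⊥) → IsPermOf (double m) pattern₁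
double-shape-of-multiples-of-3 m Σ≡9 3∣m support≥3 = from-Sum≡3 (sum≡3 t Σt≡3)
  where
  t : Fin 8 → ℕ
  t i = ℕDiv._∣_.quotient (3∣m i)
  m≡3t : ∀ i → m i ≡ t i ℕ.* 3
  m≡3t i = ℕDiv._∣_.equality (3∣m i)
  Σt≡3 : sum t ≡ 3
  Σt≡3 = ℕP.*-cancelʳ-≡ (sum t) 3 3 (trans (*-distribʳ-sum 3 t) (trans (sym (sum-cong-≗ m≡3t)) Σ≡9))
  m≡ : ∀ {i n} → t i ≡ n → m i ≡ n ℕ.* 3
  m≡ {i} ti≡n = trans (m≡3t i) (cong (ℕ._* 3) ti≡n)
  from-Sum≡3 : Sum≡3 t → IsPermOf (double m) pattern₁
  from-Sum≡3 (three k _ rest≡0) =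
    ⊥-elim (support≥3 k (punchIn k zero) (punchInᵢ≢i k zero ∘ sym) λ i i≢k _ → m≡ (rest≡0 i i≢k))
  from-Sum≡3 (two+one k l k≢l _ _ rest≡0) =
    ⊥-elim (support≥3 k l k≢l λ i i≢k i≢l → m≡ (rest≡0 i i≢k i≢l))
  from-Sum≡3 (one+one+one k l p k≢l k≢p l≢p tk tl tp rest≡0) =
    pattern₁-at (double m) k l p k≢l k≢p l≢p (double-≡ m (m≡ tk)) (double-≡ m (m≡ tl)) (double-≡ m (m≡ tp))
      (λ i i≢k i≢l i≢p → double-≡ m (m≡ (rest≡0 i i≢k i≢l i≢p)))

halfNorm : E → ℕ
halfNorm u = proj₁ (formE-definite u)

formE≡2*halfNorm : ∀ u → formE u u ≡ + (2 ℕ.* halfNorm u)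
formE≡2*halfNorm u = proj₁ (proj₂ (formE-definite u))

ν≡double : ∀ x i → ν x i ≡ double (halfNorm ∘ x) i
ν≡double x i = formE≡2*halfNorm (x i)

halfNorm≡0⇒≡0 : ∀ u → halfNorm u ≡ 0 → ∀ a → u a ≡ 0ℤ
halfNorm≡0⇒≡0 u = proj₂ (proj₂ (formE-definite u))

sum-halfNorm : ∀ x → formS x x ≡ + 18 → sum (halfNorm ∘ x) ≡ 9
sum-halfNorm x ‖x‖²≡18 = ℕP.*-cancelˡ-≡ (sum m) 9 2 (ℤP.+-injective (begin
  + (2 ℕ.* sum m)                  ≡⟨ cong +_ (*-distribˡ-sum 2 m) ⟩
  + sum (λ i → 2 ℕ.* m i)          ≡⟨ ∑-pos (λ i → 2 ℕ.* m i) ⟨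
  ∑ (double m)                     ≡⟨ ∑-cong (λ i → ν≡double x i) ⟨
  formS x x                        ≡⟨ ‖x‖²≡18 ⟩
  + 18                             ∎))
  where
  open ≡-Reasoning
  m : Fin 8 → ℕ
  m = halfNorm ∘ x

isotropic⇒3∣halfNorm : ∀ u → formE u u ≡₃ 0ℤ → 3 ℕDiv.∣ halfNorm u
isotropic⇒3∣halfNorm u q≡0 = ≈0⇒3∣ (*-cancelˡ-≈0 (+ halfNorm u) 2≉0
  (≈-trans (≈-reflexive (sym (trans (formE≡2*halfNorm u) (ℤP.pos-* 2 (halfNorm u))))) (mk q≡0)))

module Q-Element (vs ws : Fin 8 → Fin 4 → E) (Δ : ∀ i → IsDPair (vs i) (ws i))
                 (b : Fin 8 → S) (b⊆VT : ∀ t → InVT vs (b t)) (p₂ : P2 vs b)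
                 (x y z : S) (y∈B : InSpanS b y) (z∈B⊥ : InBperp ws b z) (x≡y+z : x ≡₃S (y +S z)) where

  x≈y+z : ∀ i a → x i a ≈ y i a + z i a
  x≈y+z i a = mk (x≡y+z i a)

  y∈V : ∀ i → InSpanE (vs i) (y i)
  y∈V i = span-resp {v = vs i} (λ a → ≈-sym (mk {y i a} {combS c b i a} (y≡c i a)))
                               (span-comb {v = vs i} c (λ t → b t i) (λ t → b⊆VT t i))
    where
    c = proj₁ y∈B
    y≡c = proj₂ y∈B

  z∈W : ∀ i → InSpanE (ws i) (z i)
  z∈W = proj₁ z∈B⊥

  x≡0⇒y≡₃0 : ∀ i → (∀ a → x i a ≡ 0ℤ) → ∀ a → y i a ≡₃ 0ℤ
  x≡0⇒y≡₃0 i xi≡0 = proj₂ (proj₂ (Δ i)) (y i) (y∈V i)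
    (span-resp {v = ws i} (λ a → ≈-sym (+≈0⇒≈- (y i a) (z i a) (≈-trans (≈-sym (x≈y+z i a)) (≈-reflexive (xi≡0 a)))))
                          (span-neg {v = ws i} {z i} (z∈W i)))

  zeros-unique : ¬ (y ≡₃S 0S) → ∀ i j → (∀ a → x i a ≡ 0ℤ) → (∀ a → x j a ≡ 0ℤ) → i ≡ j
  zeros-unique y≢0 i j xi≡0 xj≡0 = decidable-stable (i FinP.≟ j) λ i≢j →
    y≢0 (proj₁ (p₂ i j i≢j) y y∈B (x≡0⇒y≡₃0 i xi≡0) (x≡0⇒y≡₃0 j xj≡0))

  module _ (y≡0 : y ≡₃S 0S) where

    x≈z : ∀ i a → x i a ≈ z i a
    x≈z i a = ≈-trans (x≈y+z i a) (≈-trans (+-cong (mk {y i a} {0ℤ} (y≡0 i a)) (≈-refl {z i a}))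
                                            (≈-reflexive (ℤP.+-identityˡ (z i a))))

    x∈W : ∀ i → InSpanE (ws i) (x i)
    x∈W i = span-resp {v = ws i} (λ a → ≈-sym (x≈z i a)) (z∈W i)

    3∣halfNorm : ∀ i → 3 ℕDiv.∣ halfNorm (x i)
    3∣halfNorm i = isotropic⇒3∣halfNorm (x i) (proj₂ (proj₁ (proj₂ (Δ i))) (x i) (x∈W i))

    isolated⊥V : ∀ i j → i ≢ j → (∀ k → k ≢ i → k ≢ j → ∀ a → x k a ≡ 0ℤ) → ∀ s → formE (x i) (vs i s) ≈ 0ℤ
    isolated⊥V i j i≢j x≡0-elsewhere s =
      paired (proj₂ (p₂ i j i≢j) (vs i s) 0E (basis∈span {v = vs i} s) (0∈span {v = vs j}))
      where
      paired : (Σ S λ y′ → InSpanS b y′ × y′ i ≡₃E vs i s × y′ j ≡₃E 0E) → formE (x i) (vs i s) ≈ 0ℤ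
      paired (y′ , y′∈B , y′ᵢ≡v , y′ⱼ≡0) = begin
        formE (x i) (vs i s)  ≈⟨ form-cong-≈ cartan {x i} {x i} {vs i s} {y′ i} (λ _ → ≈-refl)
                                                 (λ a → ≈-sym (mk {y′ i a} {vs i s a} (y′ᵢ≡v a))) ⟩
        formE (x i) (y′ i)    ≈⟨ ∑-single-≈ {f = λ k → formE (x k) (y′ k)} i other≈0 ⟨
        formS x y′            ≈⟨ ∑-cong-≈ (λ k → form-cong-≈ cartan {x k} {z k} {y′ k} {y′ k} (x≈z k) (λ _ → ≈-refl)) ⟩
        formS z y′            ≈⟨ mk {formS z y′} {0ℤ} (proj₂ z∈B⊥ y′ y′∈B) ⟩
        0ℤ                    ∎
        where
        open ≈-Reasoning
        other≈0 : ∀ k → k ≢ i → formE (x k) (y′ k) ≈ 0ℤ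
        other≈0 k k≢i = by-cases k k≢i (k FinP.≟ j)
          where
          by-cases : ∀ k → k ≢ i → Dec (k ≡ j) → formE (x k) (y′ k) ≈ 0ℤ
          by-cases k _ (yes refl) =
            ≈-trans (form-cong-≈ cartan {x k} {x k} {y′ k} {0E} (λ _ → ≈-refl) (λ a → mk {y′ j a} {0ℤ} (y′ⱼ≡0 a)))
                    (≈-reflexive (form-zeroʳ cartan (x k)))
          by-cases k k≢i (no k≢j) =
            ≈-trans (form-cong-≈ cartan {x k} {0E} {y′ k} {y′ k} (λ a → ≈-reflexive (x≡0-elsewhere k k≢i k≢j a))
                                                               (λ _ → ≈-refl))
                    (≈-reflexive (form-zeroˡ cartan (y′ k)))

    support≥3 : ¬ (x ≡₃S 0S) → ∀ i j → i ≢ j → (∀ k → k ≢ i → k ≢ j → halfNorm (x k) ≡ 0) → ⊥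
    support≥3 x≢0 i j i≢j halfNorm≡0 = x≢0 λ k a → get (x≈0 k (k FinP.≟ i) (k FinP.≟ j) a)
      where
      x≡0-elsewhere : ∀ k → k ≢ i → k ≢ j → ∀ a → x k a ≡ 0ℤ
      x≡0-elsewhere k k≢i k≢j = halfNorm≡0⇒≡0 (x k) (halfNorm≡0 k k≢i k≢j)
      x≈0 : ∀ k → Dec (k ≡ i) → Dec (k ≡ j) → ∀ a → x k a ≈ 0ℤ
      x≈0 k (yes refl) _ = orthogonal-to-V⇒≈0 {vs k} {ws k} (Δ k) (x k) (x∈W k) (isolated⊥V i j i≢j x≡0-elsewhere)
      x≈0 k (no _) (yes refl) = orthogonal-to-V⇒≈0 {vs k} {ws k} (Δ k) (x k) (x∈W k)
                                  (isolated⊥V j i (i≢j ∘ sym) λ k′ k′≢j k′≢i → x≡0-elsewhere k′ k′≢i k′≢j)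
      x≈0 k (no k≢i) (no k≢j) a = ≈-reflexive (x≡0-elsewhere k k≢i k≢j a)

proposition3p1 : (vs ws : Fin 8 → Fin 4 → E) → (∀ i → IsDPair (vs i) (ws i))
    → (b : Fin 8 → S) → IsSubspaceOfVT vs b → P2 vs b
    → (x : S) → InQ vs ws b x → formS x x ≡ + 18 → ¬ (x ≡₃S 0S)
    → NuShape x
proposition3p1 vs ws Δ b (_ , b⊆VT) p₂ x (y , z , y∈B , z∈B⊥ , x≡y+z) ‖x‖²≡18 x≢0 =
  Shape-resp (λ i → sym (ν≡double x i)) (shape (all? λ i → all? λ a → y i a ≡₃? 0ℤ))
  where
  open Q-Element vs ws Δ b b⊆VT p₂ x y z y∈B z∈B⊥ x≡y+z
  m : Fin 8 → ℕ
  m = halfNorm ∘ x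
  Σm≡9 : sum m ≡ 9
  Σm≡9 = sum-halfNorm x ‖x‖²≡18
  shape : Dec (y ≡₃S 0S) → Shape (double m)
  shape (yes y≡0) = inj₁ (double-shape-of-multiples-of-3 m Σm≡9 (3∣halfNorm y≡0) (support≥3 y≡0 x≢0))
  shape (no  y≢0) = inj₂ (double-shape-with-unique-zero m Σm≡9 λ i j mi≡0 mj≡0 →
                      zeros-unique y≢0 i j (halfNorm≡0⇒≡0 (x i) mi≡0) (halfNorm≡0⇒≡0 (x j) mj≡0))
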